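{- For every typed signature $(S,\Sigma)$, the category of representations of $(S,\Sigma)$ (in monads on categories of set families, as defined in the context) has an initial object.
   Context: An algebraic signature $S$ is a set $J_S$ with a map $S:J_S\to\mathbb{N}$. An $S$-algebra is a set $T$ with operations $j^T:T^{S(j)}\to T$ for $j\in J_S$; a morphism of $S$-algebras is a map commuting with all operations. For $n\in\mathbb{N}$, $S(n)$ is the set of terms built from the operations of $S$ and variables $1,\dots,n$; for an $S$-algebra $T$ and $\mathbf{t}=(t_1,\dots,t_n)\in T^n$, each $s\in S(n)$ evaluates to $s(\mathbf{t})\in T$ (variable $m\mapsto t_m$), and for an $S$-algebra morphism $g$, $g(s(\mathbf{t}))=s(g\circ\mathbf{t})$. For a set $T$, $\mathbf{Set}^T$ is the category of $T$-indexed families of sets with componentwise maps. For $u\in T$ and $V\in\mathbf{Set}^T$, $V^{*u}=V+D(u)$ where $D(u)_u=\{*\}$ and $D(u)_t=\emptyset$ for $t\ne u$; for a finite list $\tau=(u_1,\dots,u_k)$, $V^{*\tau}$ is the iterated extension. For a map $g:T\to T'$, the retyping functor $g_!:\mathbf{Set}^T\to\mathbf{Set}^{T'}$ is $(g_!V)_{t'}=\coprod_{t:g(t)=t'}V_t$, with canonical maps $\mathrm{ctype}:V_t\to(g_!V)_{g(t)}$; there is a canonical isomorphism $g_!(V^{*u})\cong(g_!V)^{*g(u)}$. A monad on $\mathbf{Set}^T$ (Kleisli form) is $(P,\eta,\sigma)$: $PV\in\mathbf{Set}^T$, $\eta_V:V\to PV$, and for $f:V\to PW$ a morphism $\sigma(f):PV\to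 PW$, with $\sigma(f)\circ\eta_V=f$, $\sigma(\eta_V)=\mathrm{id}$, $\sigma(g)\circ\sigma(f)=\sigma(\sigma(g)\circ f)$; write $P(h)=\sigma(\eta\circ h)$ and, for $f:V\to PW$, $f^{\uparrow u}:V^{*u}\to P(W^{*u})$ given by $P(\mathrm{inl})\circ f$ on $V$ and $*\mapsto\eta(\mathrm{inr}\,*)$ (iterated for lists). An $S$-monad is a pair $(T,P)$ of an $S$-algebra $T$ and a monad $P$ on $\mathbf{Set}^T$. A morphism of $S$-monads $(T,P)\to(T',P')$ is a pair $(g,f)$ of an $S$-algebra morphism $g:T\to T'$ and morphisms $f_V:g_!(PV)\to P'(g_!V)$ in $\mathbf{Set}^{T'}$ such that $f_W\circ g_!(\sigma^P(h))=\sigma^{P'}(f_W\circ g_!(h))\circ f_V$ for all $h:V\to PW$ and $f_V\circ g_!(\eta^P_V)=\eta^{P'}_{g_!V}$; write $f^\flat_V=f_V\circ\mathrm{ctype}:(PV)_t\to(P'(g_!V))_{g(t)}$. A classic arity of degree $n$ over $S$ consists of an output type $\sigma_0\in S(n)$ and a list of inputs $((\tau_1,\sigma_1),\dots,(\tau_k,\sigma_k))$ with $\sigma_i\in S(n)$ and $\tau_i$ finite lists of elements of $S(n)$. A typed signature $(S,\Sigma)$ is an algebraic signature $S$ together with a family $\Sigma=(\alpha_j)_{j\in J}$ of classic arities over $S$, $\alpha_j$ of some degree $d(j)$. For such $\alpha$, an $S$-monad $(T,P)$, $\mathbf{t}\in T^n$ and $V\in\mathbf{Set}^T$, put $\mathrm{dom}(\alpha,P,\mathbf{t})(V)=\prod_{i=1}^k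 P(V^{*\tau_i(\mathbf{t})})_{\sigma_i(\mathbf{t})}$ and $\mathrm{cod}(\alpha,P,\mathbf{t})(V)=P(V)_{\sigma_0(\mathbf{t})}$, where $\tau_i(\mathbf{t})$ is evaluated entrywise; a map $f:V\to PW$ acts on $\mathrm{dom}$ by $\sigma(f^{\uparrow\tau_i(\mathbf{t})})_{\sigma_i(\mathbf{t})}$ in the $i$-th component and on $\mathrm{cod}$ by $\sigma(f)_{\sigma_0(\mathbf{t})}$. A representation of $(S,\Sigma)$ is an $S$-monad $(T,P)$ together with, for each $j\in J$ and $\mathbf{t}\in T^{d(j)}$, a family of maps $\alpha_j^P(\mathbf{t})_V:\mathrm{dom}(\alpha_j,P,\mathbf{t})(V)\to\mathrm{cod}(\alpha_j,P,\mathbf{t})(V)$ commuting with the actions of all $f:V\to PW$. A morphism of representations is a morphism $(g,f)$ of $S$-monads such that for all $j$, $\mathbf{t}$, $V$ and $x=(x_1,\dots,x_k)\in\mathrm{dom}(\alpha_j,P,\mathbf{t})(V)$: $f^\flat_V(\alpha_j^P(\mathbf{t})_V(x))=\alpha_j^{P'}(g\circ\mathbf{t})_{g_!V}\bigl((\iota_i(f^\flat_{V^{*\tau_i(\mathbf{t})}}(x_i)))_i\bigr)$, where $\iota_i$ is induced by the canonical isomorphism $g_!(V^{*\tau_i(\mathbf{t})})\cong(g_!V)^{*\tau_i(g\circ\mathbf{t})}$ (using $g(s(\mathbf{t}))=s(g\circ\mathbf{t})$). Composition is composition of type maps and of the monad morphisms (via $g'_!g_!\cong(g'g)_!$). -}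

module Defs where

open import Data.Nat using (ℕ)
open import Data.Fin using (Fin)
open import Data.Vec using (Vec; []; _∷_; lookup; map)
open import Data.Vec.Properties using (lookup-map)
open import Data.List as L using (List; []; _∷_)
open import Data.Product using (Σ; Σ-syntax; _×_; _,_; proj₁; proj₂)
open import Data.Sum using (_⊎_; inj₁; inj₂)
open import Data.Unit using (⊤; tt)
open import Relation.Binary.PropositionalEquality
  using (_≡_; refl; sym; trans; cong; cong₂; subst)

record AlgSig : Set₁ where
  field
    JS : Set
    ar : JS → ℕ
open AlgSig public

-- T^{S(j)} is rendered as Vec T (S(j)).
record SAlg (S : AlgSig) : Set₁ where
  field
    Car : Set
    op  : (j : JS S) → Vec Car (ar S j) → Car
open SAlg public

IsSAlgMor : {S : AlgSig} (A B : SAlg S) → (Car A → Car B) → Set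
IsSAlgMor {S} A B g = ∀ (j : JS S) (ts : Vec (Car A) (ar S j)) →
  g (op A j ts) ≡ op B j (map g ts)

-- S(n): terms in the variables 1..n (rendered as Fin n)
data Term (S : AlgSig) (n : ℕ) : Set where
  var : Fin n → Term S n
  app : (j : JS S) → Vec (Term S n) (ar S j) → Term S n

module _ {S : AlgSig} (A : SAlg S) where
  mutual
    eval : ∀ {n} → Term S n → Vec (Car A) n → Car A
    eval (var i)    t = lookup t i
    eval (app j ss) t = op A j (evals ss t)

    evals : ∀ {n m} → Vec (Term S n) m → Vec (Car A) n → Vec (Car A) m
    evals []       t = []
    evals (s ∷ ss) t = eval s t ∷ evals ss t

module _ {S : AlgSig} (A B : SAlg S) (g : Car A → Car B) (hom : IsSAlgMor A B g) where
  mutual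
    eval-hom : ∀ {n} (s : Term S n) (t : Vec (Car A) n) →
               g (eval A s t) ≡ eval B s (map g t)
    eval-hom (var i)    t = sym (lookup-map i g t)
    eval-hom (app j ss) t = trans (hom j (evals A ss t)) (cong (op B j) (evals-hom ss t))

    evals-hom : ∀ {n m} (ss : Vec (Term S n) m) (t : Vec (Car A) n) →
                map g (evals A ss t) ≡ evals B ss (map g t)
    evals-hom []       t = refl
    evals-hom (s ∷ ss) t = cong₂ _∷_ (eval-hom s t) (evals-hom ss t)

  evalList-hom : ∀ {n} (τ : List (Term S n)) (t : Vec (Car A) n) →
                 L.map g (L.map (λ s → eval A s t) τ) ≡ L.map (λ s → eval B s (map g t)) τ
  evalList-hom []      t = refl
  evalList-hom (s ∷ τ) t = cong₂ _∷_ (eval-hom s t) (evalList-hom τ t)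

Fam : Set → Set₁
Fam T = T → Set

_⇒_ : {T : Set} → Fam T → Fam T → Set
_⇒_ {T} V W = ∀ (t : T) → V t → W t
infix 4 _⇒_

_≈_ : {T : Set} {V W : Fam T} → V ⇒ W → V ⇒ W → Set
_≈_ {T} {V} f h = ∀ (t : T) (x : V t) → f t x ≡ h t x
infix 4 _≈_

_∘ᶠ_ : {T : Set} {U V W : Fam T} → V ⇒ W → U ⇒ V → U ⇒ W
(f ∘ᶠ h) t x = f t (h t x)

idᶠ : {T : Set} {V : Fam T} → V ⇒ V
idᶠ t x = x

data D {T : Set} (u : T) : T → Set where
  * : D u u

_⁺_ : {T : Set} → Fam T → T → Fam T
(V ⁺ u) t = V t ⊎ D u t

_⁺*_ : {T : Set} → Fam T → List T → Fam T
V ⁺* []      = V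
V ⁺* (u ∷ τ) = (V ⁺ u) ⁺* τ

inlᶠ : {T : Set} {V : Fam T} {u : T} → V ⇒ V ⁺ u
inlᶠ t x = inj₁ x

ext⁺ : {T : Set} {V W : Fam T} (u : T) → V ⇒ W → V ⁺ u ⇒ W ⁺ u
ext⁺ u f t (inj₁ x) = inj₁ (f t x)
ext⁺ u f t (inj₂ d) = inj₂ d

ext⁺* : {T : Set} {V W : Fam T} (τ : List T) → V ⇒ W → V ⁺* τ ⇒ W ⁺* τ
ext⁺* []      f = f
ext⁺* (u ∷ τ) f = ext⁺* τ (ext⁺ u f)

_! : {T T' : Set} → (T → T') → Fam T → Fam T'
(g !) V t' = Σ[ t ∈ _ ] (g t ≡ t') × V t

ctype : {T T' : Set} (g : T → T') {V : Fam T} (t : T) → V t → (g !) V (g t)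
ctype g t x = t , refl , x

retype : {T T' : Set} (g : T → T') {V W : Fam T} → V ⇒ W → (g !) V ⇒ (g !) W
retype g f t' (t , p , x) = t , p , f t x

-- canonical iso g_!(V^{*u}) ≅ (g_!V)^{*g(u)} (the direction used)
can⁺ : {T T' : Set} (g : T → T') {V : Fam T} (u : T) → (g !) (V ⁺ u) ⇒ ((g !) V) ⁺ g u
can⁺ g u t' (t , p , inj₁ x) = inj₁ (t , p , x)
can⁺ g u .(g u) (.u , refl , inj₂ *) = inj₂ *

can⁺* : {T T' : Set} (g : T → T') {V : Fam T} (τ : List T) →
        (g !) (V ⁺* τ) ⇒ ((g !) V) ⁺* L.map g τ
can⁺* g []      = idᶠ
can⁺* g {V} (u ∷ τ) = ext⁺* (L.map g τ) (can⁺ g u) ∘ᶠ can⁺* g {V ⁺ u} τ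

record Monad (T : Set) : Set₁ where
  field
    P    : Fam T → Fam T
    η    : ∀ {V} → V ⇒ P V
    σ    : ∀ {V W} → V ⇒ P W → P V ⇒ P W
    -- σ respects pointwise equality (automatic for set-theoretic functions)
    σ-cong : ∀ {V W} {f h : V ⇒ P W} → f ≈ h → σ f ≈ σ h
    σ-η  : ∀ {V W} (f : V ⇒ P W) → (σ f ∘ᶠ η) ≈ f
    σ-id : ∀ {V} → σ (η {V}) ≈ idᶠ
    σ-σ  : ∀ {U V W} (f : U ⇒ P V) (h : V ⇒ P W) → (σ h ∘ᶠ σ f) ≈ σ (σ h ∘ᶠ f)

  Pmap : ∀ {V W} → V ⇒ W → P V ⇒ P W
  Pmap h = σ (η ∘ᶠ h)

  _↑_ : ∀ {V W} → V ⇒ P W → (u : T) → V ⁺ u ⇒ P (W ⁺ u)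
  (f ↑ u) t (inj₁ x) = Pmap inlᶠ t (f t x)
  (f ↑ u) t (inj₂ d) = η t (inj₂ d)

  _↑*_ : ∀ {V W} → V ⇒ P W → (τ : List T) → V ⁺* τ ⇒ P (W ⁺* τ)
  f ↑* []      = f
  f ↑* (u ∷ τ) = (f ↑ u) ↑* τ
open Monad public

record SMonad (S : AlgSig) : Set₁ where
  field
    alg : SAlg S
    mon : Monad (Car alg)
open SMonad public

record SMonadMor {S : AlgSig} (M N : SMonad S) : Set₁ where
  field
    g     : Car (alg M) → Car (alg N)
    g-hom : IsSAlgMor (alg M) (alg N) g
    f     : ∀ (V : Fam (Car (alg M))) → (g !) (Monad.P (mon M) V) ⇒ Monad.P (mon N) ((g !) V)
    f-σ   : ∀ {V W : Fam (Car (alg M))} (h : V ⇒ Monad.P (mon M) W) →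
            (f W ∘ᶠ retype g (Monad.σ (mon M) h))
              ≈ (Monad.σ (mon N) (f W ∘ᶠ retype g h) ∘ᶠ f V)
    f-η   : ∀ {V : Fam (Car (alg M))} → (f V ∘ᶠ retype g (Monad.η (mon M))) ≈ Monad.η (mon N)

  f♭ : ∀ (V : Fam (Car (alg M))) (t : Car (alg M)) → Monad.P (mon M) V t → Monad.P (mon N) ((g !) V) (g t)
  f♭ V t x = f V (g t) (ctype g t x)
open SMonadMor public

record Arity (S : AlgSig) (n : ℕ) : Set where
  field
    out : Term S n
    ins : List (List (Term S n) × Term S n)
open Arity public

record TypedSig : Set₁ where
  field
    S   : AlgSig
    J   : Set
    deg : J → ℕ
    α   : (j : J) → Arity S (deg j)
open TypedSig public

module _ {S : AlgSig} (M : SMonad S) where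
  private
    A = alg M
    T = Car A
    Mo = mon M

  evτ : ∀ {n} → List (Term S n) → Vec T n → List T
  evτ τ t = L.map (λ s → eval A s t) τ

  Dom' : ∀ {n} → List (List (Term S n) × Term S n) → Vec T n → Fam T → Set
  Dom' []             t V = ⊤
  Dom' ((τ , s) ∷ is) t V = P Mo (V ⁺* evτ τ t) (eval A s t) × Dom' is t V

  Dom : ∀ {n} → Arity S n → Vec T n → Fam T → Set
  Dom a = Dom' (ins a)

  Cod : ∀ {n} → Arity S n → Vec T n → Fam T → Set
  Cod a t V = P Mo V (eval A (out a) t)

  domAct' : ∀ {n} (is : List (List (Term S n) × Term S n)) (t : Vec T n)
            {V W : Fam T} → V ⇒ P Mo W → Dom' is t V → Dom' is t W
  domAct' []             t f tt       = tt
  domAct' ((τ , s) ∷ is) t f (x , xs) =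
    σ Mo (_↑*_ Mo f (evτ τ t)) (eval A s t) x , domAct' is t f xs

  codAct : ∀ {n} (a : Arity S n) (t : Vec T n) {V W : Fam T} →
           V ⇒ P Mo W → Cod a t V → Cod a t W
  codAct a t f x = σ Mo f (eval A (out a) t) x

record Rep (Sig : TypedSig) : Set₁ where
  field
    smon : SMonad (S Sig)
  private
    T = Car (alg smon)
  field
    rep  : ∀ (j : J Sig) (t : Vec T (deg Sig j)) (V : Fam T) →
           Dom smon (α Sig j) t V → Cod smon (α Sig j) t V
    rep-nat : ∀ (j : J Sig) (t : Vec T (deg Sig j)) {V W : Fam T}
              (f : V ⇒ P (mon smon) W) (x : Dom smon (α Sig j) t V) →
              rep j t W (domAct' smon (ins (α Sig j)) t f x)
                ≡ codAct smon (α Sig j) t f (rep j t V x)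
open Rep public

module _ {Sig : TypedSig} (R R' : Rep Sig) (m : SMonadMor (smon R) (smon R')) where
  private
    SS = S Sig
    A  = alg (smon R)
    B  = alg (smon R')
    T  = Car A
    M' = mon (smon R')
    gg = g m
    hom = g-hom m

  ι : ∀ {n} (τ : List (Term SS n)) (s : Term SS n) (t : Vec T n) (V : Fam T) →
      P M' ((gg !) (V ⁺* evτ (smon R) τ t)) (gg (eval A s t)) →
      P M' (((gg !) V) ⁺* evτ (smon R') τ (map gg t)) (eval B s (map gg t))
  ι τ s t V x =
    subst (P M' (((gg !) V) ⁺* evτ (smon R') τ (map gg t))) (eval-hom A B gg hom s t)
      (Pmap M' (λ t' y → subst (λ us → ((gg !) V ⁺* us) t') (evalList-hom A B gg hom τ t)
                           (can⁺* gg {V} (evτ (smon R) τ t) t' y))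
               (gg (eval A s t)) x)

  mapDom : ∀ {n} (is : List (List (Term SS n) × Term SS n)) (t : Vec T n) (V : Fam T) →
           Dom' (smon R) is t V → Dom' (smon R') is (map gg t) ((gg !) V)
  mapDom []             t V tt       = tt
  mapDom ((τ , s) ∷ is) t V (x , xs) =
    ι τ s t V (f♭ m (V ⁺* evτ (smon R) τ t) (eval A s t) x) , mapDom is t V xs

  IsRepMor : Set₁
  IsRepMor = ∀ (j : J Sig) (t : Vec T (deg Sig j)) (V : Fam T)
               (x : Dom (smon R) (α Sig j) t V) →
             subst (P M' ((gg !) V)) (eval-hom A B gg hom (out (α Sig j)) t)
                   (f♭ m V (eval A (out (α Sig j)) t) (rep R j t V x))
               ≡ rep R' j (map gg t) ((gg !) V) (mapDom (ins (α Sig j)) t V x)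

record RepMor {Sig : TypedSig} (R R' : Rep Sig) : Set₁ where
  field
    mor    : SMonadMor (smon R) (smon R')
    is-rep : IsRepMor R R' mor
open RepMor public

-- Equality of morphisms of representations: the type maps agree, and the
-- monad-morphism components agree once the type maps are identified.
module _ {Sig : TypedSig} {R R' : Rep Sig} where
  private
    T = Car (alg (smon R))
  ρ : {g₁ g₂ : T → Car (alg (smon R'))} → (∀ t → g₁ t ≡ g₂ t) →
      {V : Fam T} → (g₁ !) V ⇒ (g₂ !) V
  ρ e t' (t , p , x) = t , trans (sym (e t)) p , x

  RepMorEq : RepMor R R' → RepMor R R' → Set₁
  RepMorEq m₁ m₂ =
    Σ[ e ∈ (∀ t → g (mor m₁) t ≡ g (mor m₂) t) ]
      (∀ (V : Fam T) (t' : Car (alg (smon R'))) (y : (g (mor m₁) !) (P (mon (smon R)) V) t') →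
         Pmap (mon (smon R')) (ρ e) t' (f (mor m₁) V t' y)
           ≡ f (mor m₂) V t' (ρ e t' y))

HasInitialRep : TypedSig → Set₁
HasInitialRep Sig =
  Σ[ R ∈ Rep Sig ] (∀ (R' : Rep Sig) →
    Σ[ m ∈ RepMor R R' ] (∀ (m' : RepMor R R') → RepMorEq m m'))

module Submission where

-- The initial representation R₀ is syntax: its types are the initial
-- S-algebra T₀ of closed S-terms, and its monad sends V to the family Tm V
-- of well-typed terms, with one constructor per symbol j and instantiation
-- ts ∈ T₀^{d(j)}, taking an argument in context V^{*τᵢ(ts)} of type σᵢ(ts)
-- for each input (τᵢ , σᵢ) of α_j.  Substitution is the Kleisli extension;
-- the monad laws are the fusion laws of renaming and substitution.
--
-- For a representation R', the morphism R₀ → R' has the fold T₀ → T' as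
-- type map and interprets terms by structural recursion; interpretation
-- commutes with renaming and substitution.  For uniqueness, a morphism m'
-- has the fold as type map up to pointwise equality, its monad part is the
-- interpretation along its own type map, and interpretations along
-- pointwise equal type maps agree up to the reindexing ρ of RepMorEq.

open import Defs
open import Function using (_∘_)
open import Data.Nat using (ℕ)
open import Data.Vec using (Vec; []; _∷_; map)
open import Data.List as L using (List; []; _∷_)
open import Data.Product using (_×_; _,_)
open import Data.Sum using (inj₁; inj₂)
open import Data.Unit using (⊤; tt)
open import Relation.Binary.PropositionalEquality
  using (_≡_; refl; sym; trans; cong; cong₂; subst; module ≡-Reasoning)
open import Relation.Binary.PropositionalEquality.Properties
  using (subst-application′; subst-subst-sym; subst-sym-subst)
open import Axiom.UniquenessOfIdentityProofs.WithK using (uip)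

open ≡-Reasoning

module _ {T : Set} where

  ext⁺*-cong : {V W : Fam T} (L : List T) {k k' : V ⇒ W} →
               k ≈ k' → ext⁺* L k ≈ ext⁺* L k'
  ext⁺*-cong []      e = e
  ext⁺*-cong (u ∷ L) e = ext⁺*-cong L λ where
    t (inj₁ x) → cong inj₁ (e t x)
    t (inj₂ d) → refl

  ext⁺*-∘ : {U V W : Fam T} (L : List T) {k : V ⇒ W} {k' : U ⇒ V} {k'' : U ⇒ W} →
            (k ∘ᶠ k') ≈ k'' → (ext⁺* L k ∘ᶠ ext⁺* L k') ≈ ext⁺* L k''
  ext⁺*-∘ []      e = e
  ext⁺*-∘ (u ∷ L) e = ext⁺*-∘ L λ where
    t (inj₁ x) → cong inj₁ (e t x)
    t (inj₂ d) → refl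

module _ {T : Set} where

  subst-inj₁ : ∀ {Y : Fam T} {t a₁ a₂} (eu : a₁ ≡ a₂) {y : Y t} →
               subst (λ a → (Y ⁺ a) t) eu (inj₁ y) ≡ inj₁ y
  subst-inj₁ refl = refl

  subst-∷ : ∀ (Y : Fam T) t {a₁ a₂ l₁ l₂} (eu : a₁ ≡ a₂) (eL : l₁ ≡ l₂) z →
            subst (λ us → (Y ⁺* us) t) (cong₂ _∷_ eu eL) z
              ≡ subst (λ us → ((Y ⁺ a₂) ⁺* us) t) eL
                      (subst (λ a → ((Y ⁺ a) ⁺* l₁) t) eu z)
  subst-∷ Y t refl refl z = refl

  subst-ext⁺* : ∀ {X Y : Fam T} l {a₁ a₂} (eu : a₁ ≡ a₂)
                (k₁ : X ⇒ Y ⁺ a₁) (k₂ : X ⇒ Y ⁺ a₂) →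
                (∀ t z → subst (λ a → (Y ⁺ a) t) eu (k₁ t z) ≡ k₂ t z) →
                ∀ t w → subst (λ a → ((Y ⁺ a) ⁺* l) t) eu (ext⁺* l k₁ t w)
                          ≡ ext⁺* l k₂ t w
  subst-ext⁺* l refl k₁ k₂ hyp = ext⁺*-cong l hyp

  subst-ext⁺*-∘ : ∀ {X Y Z : Fam T} {l₁ l₂} (eL : l₁ ≡ l₂) (k : Z ⇒ Y) (r : X ⇒ Z)
                  t w →
                  subst (λ us → (Y ⁺* us) t) eL (ext⁺* l₁ (k ∘ᶠ r) t w)
                    ≡ ext⁺* l₂ k t (subst (λ us → (Z ⁺* us) t) eL (ext⁺* l₁ r t w))
  subst-ext⁺*-∘ {l₁ = l} refl k r t w = sym (ext⁺*-∘ l (λ _ _ → refl) t w)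

-- Coherences of transport, by uniqueness of identity proofs.
module _ {A D : Set} where

  transport-square : ∀ {C : Set} (Q : C → D → Set) (h : A → C) (f : A → D)
                     {v₁ v₂ : A} (ve : v₁ ≡ v₂) {a b : D}
                     (p₁ : a ≡ f v₁) (p₂ : b ≡ f v₂) (q : b ≡ a) (w : Q (h v₁) a) →
                     subst (Q (h v₂)) p₂
                       (subst (Q (h v₂)) (sym q) (subst (λ c → Q c a) (cong h ve) w))
                       ≡ subst (λ v → Q (h v) (f v)) ve (subst (Q (h v₁)) p₁ w)
  transport-square Q h f refl p₁ refl refl w with uip p₁ refl
  ... | refl = refl

  transport-app : (E : A → Set) (f : A → D) (Q : D → Set) (F : ∀ v → E v → Q (f v))
                  {v₁ v₂ : A} (ve : v₁ ≡ v₂) (d₁ : E v₁) (d₂ : E v₂) → d₂ ≡ subst E ve d₁ →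
                  ∀ {a b} (p₁ : f v₁ ≡ a) (p₂ : f v₂ ≡ b) (p₃ : b ≡ a) →
                  subst Q p₁ (F v₁ d₁) ≡ subst Q p₃ (subst Q p₂ (F v₂ d₂))
  transport-app E f Q F refl d₁ d₂ refl p₁ refl p₃ with uip p₁ p₃
  ... | refl = refl

module _ {A : Set} where

  subst-tt : {v₁ v₂ : A} (ve : v₁ ≡ v₂) → tt ≡ subst (λ _ → ⊤) ve tt
  subst-tt refl = refl

  subst-× : (E E' : A → Set) {v₁ v₂ : A} (ve : v₁ ≡ v₂) (x : E v₁) (y : E' v₁) →
            subst (λ v → E v × E' v) ve (x , y) ≡ (subst E ve x , subst E' ve y)
  subst-× E E' refl x y = refl

module KleisliLaws {T : Set} (Mon : Monad T) where
  private module M = Monad Mon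

  Pmap-cong : ∀ {V W} {k k' : V ⇒ W} → k ≈ k' → M.Pmap k ≈ M.Pmap k'
  Pmap-cong e = M.σ-cong λ t x → cong (M.η t) (e t x)

  Pmap-η : ∀ {V W} (k : V ⇒ W) → (M.Pmap k ∘ᶠ M.η) ≈ (M.η ∘ᶠ k)
  Pmap-η k = M.σ-η (M.η ∘ᶠ k)

  Pmap-σ : ∀ {U V W} (k : V ⇒ W) (f : U ⇒ M.P V) →
           (M.Pmap k ∘ᶠ M.σ f) ≈ M.σ (M.Pmap k ∘ᶠ f)
  Pmap-σ k f = M.σ-σ f (M.η ∘ᶠ k)

  σ-Pmap : ∀ {U V W} (f : V ⇒ M.P W) (k : U ⇒ V) →
           (M.σ f ∘ᶠ M.Pmap k) ≈ M.σ (f ∘ᶠ k)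
  σ-Pmap f k t y = begin
    M.σ f t (M.Pmap k t y)          ≡⟨ M.σ-σ (M.η ∘ᶠ k) f t y ⟩
    M.σ ((M.σ f ∘ᶠ M.η) ∘ᶠ k) t y   ≡⟨ M.σ-cong (λ t' x → M.σ-η f t' (k t' x)) t y ⟩
    M.σ (f ∘ᶠ k) t y                ∎

  Pmap-∘ : ∀ {U V W} (k : V ⇒ W) (k' : U ⇒ V) →
           (M.Pmap k ∘ᶠ M.Pmap k') ≈ M.Pmap (k ∘ᶠ k')
  Pmap-∘ k k' = σ-Pmap (M.η ∘ᶠ k) k'

  Pmap-id : ∀ {V} {k : V ⇒ V} → k ≈ idᶠ → M.Pmap k ≈ idᶠ
  Pmap-id e t y = trans (Pmap-cong e t y) (M.σ-id t y)

  ↑*-η : ∀ {V W} {f : V ⇒ M.P W} {k : V ⇒ W} L →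
         f ≈ (M.η ∘ᶠ k) → (f M.↑* L) ≈ (M.η ∘ᶠ ext⁺* L k)
  ↑*-η []      e = e
  ↑*-η {k = k} (u ∷ L) e = ↑*-η L λ where
    t (inj₁ x) → trans (cong (M.Pmap inlᶠ t) (e t x)) (Pmap-η inlᶠ t (k t x))
    t (inj₂ d) → refl

  ↑*-η-Pmap : ∀ {U V W} L (k : V ⇒ W) (C : U ⇒ V ⁺* L) →
              (M.σ ((M.η ∘ᶠ k) M.↑* L) ∘ᶠ M.Pmap C) ≈ M.Pmap (ext⁺* L k ∘ᶠ C)
  ↑*-η-Pmap L k C t y =
    trans (σ-Pmap _ C t y) (M.σ-cong (λ t' z → ↑*-η L (λ _ _ → refl) t' (C t' z)) t y)

  Pmap-↑* : ∀ {V W W'} {m : W ⇒ W'} {B : V ⇒ M.P W} {B' : V ⇒ M.P W'} L →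
            (M.Pmap m ∘ᶠ B) ≈ B' → (M.Pmap (ext⁺* L m) ∘ᶠ (B M.↑* L)) ≈ (B' M.↑* L)
  Pmap-↑* []      e = e
  Pmap-↑* {m = m} {B} {B'} (u ∷ L) e = Pmap-↑* L λ where
    t (inj₁ x) → begin
      M.Pmap (ext⁺ u m) t (M.Pmap inlᶠ t (B t x))  ≡⟨ Pmap-∘ (ext⁺ u m) inlᶠ t (B t x) ⟩
      M.Pmap (inlᶠ ∘ᶠ m) t (B t x)                  ≡⟨ Pmap-∘ inlᶠ m t (B t x) ⟨
      M.Pmap inlᶠ t (M.Pmap m t (B t x))            ≡⟨ cong (M.Pmap inlᶠ t) (e t x) ⟩
      M.Pmap inlᶠ t (B' t x)                        ∎
    t (inj₂ d) → Pmap-η (ext⁺ u m) t (inj₂ d)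

  ↑*-ext : ∀ {V V' W} {m : V' ⇒ V} {B : V ⇒ M.P W} {B' : V' ⇒ M.P W} L →
           (B ∘ᶠ m) ≈ B' → ((B M.↑* L) ∘ᶠ ext⁺* L m) ≈ (B' M.↑* L)
  ↑*-ext []      e = e
  ↑*-ext (u ∷ L) e = ↑*-ext L λ where
    t (inj₁ x) → cong (M.Pmap inlᶠ t) (e t x)
    t (inj₂ d) → refl

  Pmap-transport : ∀ {I : Set} {X : Fam T} (Y : I → Fam T) {l₁ l₂} (eL : l₁ ≡ l₂)
                   (k₁ : X ⇒ Y l₁) (k₂ : X ⇒ Y l₂) →
                   (∀ t z → subst (λ l → Y l t) eL (k₁ t z) ≡ k₂ t z) →
                   ∀ a y → M.Pmap k₂ a y ≡ subst (λ l → M.P (Y l) a) eL (M.Pmap k₁ a y)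
  Pmap-transport Y refl k₁ k₂ hyp a y = sym (Pmap-cong hyp a y)

  σ-square : ∀ {X X' Y Y'} (CV : X ⇒ X') (CW : Y ⇒ Y') (H : X ⇒ M.P Y) (K : X' ⇒ M.P Y') →
             (M.Pmap CW ∘ᶠ H) ≈ (K ∘ᶠ CV) → ∀ {a b} (e : a ≡ b) y →
             subst (M.P Y') e (M.Pmap CW a (M.σ H a y))
               ≡ M.σ K b (subst (M.P X') e (M.Pmap CV a y))
  σ-square CV CW H K hyp refl y = begin
    M.Pmap CW _ (M.σ H _ y)      ≡⟨ Pmap-σ CW H _ y ⟩
    M.σ (M.Pmap CW ∘ᶠ H) _ y     ≡⟨ M.σ-cong hyp _ y ⟩
    M.σ (K ∘ᶠ CV) _ y            ≡⟨ σ-Pmap K CV _ y ⟨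
    M.σ K _ (M.Pmap CV _ y)      ∎

module InitialAlgebra (S : AlgSig) where

  T₀ : Set
  T₀ = Term S 0

  A₀ : SAlg S
  A₀ = record { Car = T₀ ; op = app }

  module _ (B : SAlg S) where
    mutual
      fold : T₀ → Car B
      fold (app j ss) = op B j (folds ss)

      folds : ∀ {m} → Vec T₀ m → Vec (Car B) m
      folds []       = []
      folds (s ∷ ss) = fold s ∷ folds ss

    folds≡map : ∀ {m} (ss : Vec T₀ m) → folds ss ≡ map fold ss
    folds≡map []       = refl
    folds≡map (s ∷ ss) = cong (fold s ∷_) (folds≡map ss)

    fold-hom : IsSAlgMor A₀ B fold
    fold-hom j ss = cong (op B j) (folds≡map ss)

    module _ (h : T₀ → Car B) (h-hom : IsSAlgMor A₀ B h) where
      mutual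
        fold-unique : ∀ t → fold t ≡ h t
        fold-unique (app j ss) = trans (cong (op B j) (folds-unique ss)) (sym (h-hom j ss))

        folds-unique : ∀ {m} (ss : Vec T₀ m) → folds ss ≡ map h ss
        folds-unique []       = refl
        folds-unique (s ∷ ss) = cong₂ _∷_ (fold-unique s) (folds-unique ss)

module Syntax (Sig : TypedSig) where
  open InitialAlgebra (S Sig) public

  Inputs : ℕ → Set
  Inputs n = List (List (Term (S Sig) n) × Term (S Sig) n)

  ctx : ∀ {n} → List (Term (S Sig) n) → Vec T₀ n → List T₀
  ctx τ ts = L.map (λ s → eval A₀ s ts) τ

  mutual
    data Tm (V : Fam T₀) : T₀ → Set where
      var : ∀ {t} → V t → Tm V t
      con : (j : J Sig) (ts : Vec T₀ (deg Sig j)) →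
            Args V ts (ins (α Sig j)) → Tm V (eval A₀ (out (α Sig j)) ts)

    Args : (V : Fam T₀) {n : ℕ} (ts : Vec T₀ n) → Inputs n → Set
    Args V ts []             = ⊤
    Args V ts ((τ , s) ∷ is) = Tm (V ⁺* ctx τ ts) (eval A₀ s ts) × Args V ts is

  varᶠ : ∀ {V} → V ⇒ Tm V
  varᶠ t v = var v

  mutual
    ren : ∀ {V W} → V ⇒ W → Tm V ⇒ Tm W
    ren k t (var v)       = var (k t v)
    ren k _ (con j ts as) = con j ts (renArgs k (ins (α Sig j)) as)

    renArgs : ∀ {V W n} {ts : Vec T₀ n} → V ⇒ W →
              (is : Inputs n) → Args V ts is → Args W ts is
    renArgs k []             tt       = tt
    renArgs {ts = ts} k ((τ , s) ∷ is) (x , xs) =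
      ren (ext⁺* (ctx τ ts) k) _ x , renArgs k is xs

  lift : ∀ {V W} → V ⇒ Tm W → (u : T₀) → V ⁺ u ⇒ Tm (W ⁺ u)
  lift f u t (inj₁ x) = ren inlᶠ t (f t x)
  lift f u t (inj₂ d) = var (inj₂ d)

  lift* : ∀ {V W} → V ⇒ Tm W → (L : List T₀) → V ⁺* L ⇒ Tm (W ⁺* L)
  lift* f []      = f
  lift* f (u ∷ L) = lift* (lift f u) L

  mutual
    sub : ∀ {V W} → V ⇒ Tm W → Tm V ⇒ Tm W
    sub f t (var v)       = f t v
    sub f _ (con j ts as) = con j ts (subArgs f (ins (α Sig j)) as)

    subArgs : ∀ {V W n} {ts : Vec T₀ n} → V ⇒ Tm W →
              (is : Inputs n) → Args V ts is → Args W ts is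
    subArgs f []             tt       = tt
    subArgs {ts = ts} f ((τ , s) ∷ is) (x , xs) =
      sub (lift* f (ctx τ ts)) _ x , subArgs f is xs

  -- Fusion laws.  Each is proved by induction on terms; the hypothesis is
  -- a pointwise equation between the maps, which is preserved under
  -- lifting through binders.
  mutual
    ren-ren : ∀ {U V W} {k : V ⇒ W} {k' : U ⇒ V} {k'' : U ⇒ W} →
              (k ∘ᶠ k') ≈ k'' → (ren k ∘ᶠ ren k') ≈ ren k''
    ren-ren e t (var v)       = cong var (e t v)
    ren-ren e _ (con j ts as) = cong (con j ts) (renArgs-ren e (ins (α Sig j)) as)

    renArgs-ren : ∀ {U V W n} {ts : Vec T₀ n} {k : V ⇒ W} {k' : U ⇒ V} {k'' : U ⇒ W} →
                  (k ∘ᶠ k') ≈ k'' → ∀ is (as : Args U ts is) →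
                  renArgs k is (renArgs k' is as) ≡ renArgs k'' is as
    renArgs-ren e []             tt       = refl
    renArgs-ren {ts = ts} e ((τ , s) ∷ is) (x , xs) =
      cong₂ _,_ (ren-ren (ext⁺*-∘ (ctx τ ts) e) _ x) (renArgs-ren e is xs)

  lift*-sub-ren : ∀ {U V W} {f : V ⇒ Tm W} {k : U ⇒ V} {h : U ⇒ Tm W} L →
                  (f ∘ᶠ k) ≈ h → (lift* f L ∘ᶠ ext⁺* L k) ≈ lift* h L
  lift*-sub-ren []      e = e
  lift*-sub-ren (u ∷ L) e = lift*-sub-ren L λ where
    t (inj₁ x) → cong (ren inlᶠ t) (e t x)
    t (inj₂ d) → refl

  mutual
    sub-ren : ∀ {U V W} {f : V ⇒ Tm W} {k : U ⇒ V} {h : U ⇒ Tm W} →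
              (f ∘ᶠ k) ≈ h → (sub f ∘ᶠ ren k) ≈ sub h
    sub-ren e t (var v)       = e t v
    sub-ren e _ (con j ts as) = cong (con j ts) (subArgs-ren e (ins (α Sig j)) as)

    subArgs-ren : ∀ {U V W n} {ts : Vec T₀ n} {f : V ⇒ Tm W} {k : U ⇒ V} {h : U ⇒ Tm W} →
                  (f ∘ᶠ k) ≈ h → ∀ is (as : Args U ts is) →
                  subArgs f is (renArgs k is as) ≡ subArgs h is as
    subArgs-ren e []             tt       = refl
    subArgs-ren {ts = ts} e ((τ , s) ∷ is) (x , xs) =
      cong₂ _,_ (sub-ren (lift*-sub-ren (ctx τ ts) e) _ x) (subArgs-ren e is xs)

  lift*-ren-sub : ∀ {U V W} {k : V ⇒ W} {f : U ⇒ Tm V} {h : U ⇒ Tm W} L →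
                  (ren k ∘ᶠ f) ≈ h → (ren (ext⁺* L k) ∘ᶠ lift* f L) ≈ lift* h L
  lift*-ren-sub []      e = e
  lift*-ren-sub {f = f} (u ∷ L) e = lift*-ren-sub L λ where
    -- both sides rename f x by k followed by the weakening inl
    t (inj₁ x) → trans (ren-ren (λ _ _ → refl) t (f t x))
                       (trans (sym (ren-ren (λ _ _ → refl) t (f t x)))
                              (cong (ren inlᶠ t) (e t x)))
    t (inj₂ d) → refl

  mutual
    ren-sub : ∀ {U V W} {k : V ⇒ W} {f : U ⇒ Tm V} {h : U ⇒ Tm W} →
              (ren k ∘ᶠ f) ≈ h → (ren k ∘ᶠ sub f) ≈ sub h
    ren-sub e t (var v)       = e t v
    ren-sub e _ (con j ts as) = cong (con j ts) (renArgs-sub e (ins (α Sig j)) as)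

    renArgs-sub : ∀ {U V W n} {ts : Vec T₀ n} {k : V ⇒ W} {f : U ⇒ Tm V} {h : U ⇒ Tm W} →
                  (ren k ∘ᶠ f) ≈ h → ∀ is (as : Args U ts is) →
                  renArgs k is (subArgs f is as) ≡ subArgs h is as
    renArgs-sub e []             tt       = refl
    renArgs-sub {ts = ts} e ((τ , s) ∷ is) (x , xs) =
      cong₂ _,_ (ren-sub (lift*-ren-sub (ctx τ ts) e) _ x) (renArgs-sub e is xs)

  lift*-sub-sub : ∀ {U V W} {h : V ⇒ Tm W} {f : U ⇒ Tm V} {k : U ⇒ Tm W} L →
                  (sub h ∘ᶠ f) ≈ k → (sub (lift* h L) ∘ᶠ lift* f L) ≈ lift* k L
  lift*-sub-sub []      e = e
  lift*-sub-sub {f = f} (u ∷ L) e = lift*-sub-sub L λ where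
    -- both sides substitute h into f x and then weaken by inl
    t (inj₁ x) → trans (sub-ren (λ _ _ → refl) t (f t x))
                       (trans (sym (ren-sub (λ _ _ → refl) t (f t x)))
                              (cong (ren inlᶠ t) (e t x)))
    t (inj₂ d) → refl

  mutual
    sub-sub : ∀ {U V W} {h : V ⇒ Tm W} {f : U ⇒ Tm V} {k : U ⇒ Tm W} →
              (sub h ∘ᶠ f) ≈ k → (sub h ∘ᶠ sub f) ≈ sub k
    sub-sub e t (var v)       = e t v
    sub-sub e _ (con j ts as) = cong (con j ts) (subArgs-sub e (ins (α Sig j)) as)

    subArgs-sub : ∀ {U V W n} {ts : Vec T₀ n} {h : V ⇒ Tm W} {f : U ⇒ Tm V} {k : U ⇒ Tm W} →
                  (sub h ∘ᶠ f) ≈ k → ∀ is (as : Args U ts is) →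
                  subArgs h is (subArgs f is as) ≡ subArgs k is as
    subArgs-sub e []             tt       = refl
    subArgs-sub {ts = ts} e ((τ , s) ∷ is) (x , xs) =
      cong₂ _,_ (sub-sub (lift*-sub-sub (ctx τ ts) e) _ x) (subArgs-sub e is xs)

  lift*-var : ∀ {V W} {f : V ⇒ Tm W} {k : V ⇒ W} L →
              f ≈ (varᶠ ∘ᶠ k) → lift* f L ≈ (varᶠ ∘ᶠ ext⁺* L k)
  lift*-var []      e = e
  lift*-var (u ∷ L) e = lift*-var L λ where
    t (inj₁ x) → cong (ren inlᶠ t) (e t x)
    t (inj₂ d) → refl

  mutual
    sub-var : ∀ {V W} {f : V ⇒ Tm W} {k : V ⇒ W} → f ≈ (varᶠ ∘ᶠ k) → sub f ≈ ren k
    sub-var e t (var v)       = e t v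
    sub-var e _ (con j ts as) = cong (con j ts) (subArgs-var e (ins (α Sig j)) as)

    subArgs-var : ∀ {V W n} {ts : Vec T₀ n} {f : V ⇒ Tm W} {k : V ⇒ W} →
                  f ≈ (varᶠ ∘ᶠ k) → ∀ is (as : Args V ts is) →
                  subArgs f is as ≡ renArgs k is as
    subArgs-var e []             tt       = refl
    subArgs-var {ts = ts} e ((τ , s) ∷ is) (x , xs) =
      cong₂ _,_ (sub-var (lift*-var (ctx τ ts) e) _ x) (subArgs-var e is xs)

  lift*-id : ∀ {V} {f : V ⇒ Tm V} L → f ≈ varᶠ → lift* f L ≈ varᶠ
  lift*-id []      e = e
  lift*-id (u ∷ L) e = lift*-id L λ where
    t (inj₁ x) → cong (ren inlᶠ t) (e t x)
    t (inj₂ d) → refl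

  mutual
    sub-id : ∀ {V} {f : V ⇒ Tm V} → f ≈ varᶠ → sub f ≈ idᶠ
    sub-id e t (var v)       = e t v
    sub-id e _ (con j ts as) = cong (con j ts) (subArgs-id e (ins (α Sig j)) as)

    subArgs-id : ∀ {V n} {ts : Vec T₀ n} {f : V ⇒ Tm V} →
                 f ≈ varᶠ → ∀ is (as : Args V ts is) → subArgs f is as ≡ as
    subArgs-id e []             tt       = refl
    subArgs-id {ts = ts} e ((τ , s) ∷ is) (x , xs) =
      cong₂ _,_ (sub-id (lift*-id (ctx τ ts) e) _ x) (subArgs-id e is xs)

  -- substitution respects pointwise equality (a consequence of fusion)
  sub-cong : ∀ {V W} {f f' : V ⇒ Tm W} → f ≈ f' → sub f ≈ sub f'
  sub-cong {f = f} {f'} e t x = begin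
    sub f t x               ≡⟨ sub-id (λ _ _ → refl) t (sub f t x) ⟨
    sub varᶠ t (sub f t x)  ≡⟨ sub-sub varᶠ-f≈f' t x ⟩
    sub f' t x              ∎
    where
      varᶠ-f≈f' : (sub varᶠ ∘ᶠ f) ≈ f'
      varᶠ-f≈f' t' v = trans (sub-id (λ _ _ → refl) t' (f t' v)) (e t' v)

  M₀ : Monad T₀
  M₀ = record
    { P      = Tm
    ; η      = varᶠ
    ; σ      = sub
    ; σ-cong = sub-cong
    ; σ-η    = λ f t x → refl
    ; σ-id   = sub-id (λ _ _ → refl)
    ; σ-σ    = λ f h → sub-sub (λ _ _ → refl)
    }

  SM₀ : SMonad (S Sig)
  SM₀ = record { alg = A₀ ; mon = M₀ }

  ↑*≈lift* : ∀ {V W} {f f' : V ⇒ Tm W} L → f ≈ f' → (_↑*_ M₀ f L) ≈ lift* f' L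
  ↑*≈lift* []      e = e
  ↑*≈lift* (u ∷ L) e = ↑*≈lift* L λ where
    t (inj₁ x) → trans (sub-var (λ _ _ → refl) t _) (cong (ren inlᶠ t) (e t x))
    t (inj₂ d) → refl

  fromDom : ∀ {V n} {ts : Vec T₀ n} is → Dom' SM₀ is ts V → Args V ts is
  fromDom []             tt       = tt
  fromDom ((τ , s) ∷ is) (x , xs) = x , fromDom is xs

  toDom : ∀ {V n} {ts : Vec T₀ n} is → Args V ts is → Dom' SM₀ is ts V
  toDom []             tt       = tt
  toDom ((τ , s) ∷ is) (x , xs) = x , toDom is xs

  fromDom-toDom : ∀ {V n} {ts : Vec T₀ n} is (as : Args V ts is) →
                  fromDom is (toDom is as) ≡ as
  fromDom-toDom []             tt       = refl
  fromDom-toDom ((τ , s) ∷ is) (x , xs) = cong (x ,_) (fromDom-toDom is xs)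

  fromDom-act : ∀ {V W n} (ts : Vec T₀ n) is (f : V ⇒ Tm W) (d : Dom' SM₀ is ts V) →
                fromDom is (domAct' SM₀ is ts f d) ≡ subArgs f is (fromDom is d)
  fromDom-act ts []             f tt       = refl
  fromDom-act ts ((τ , s) ∷ is) f (x , xs) =
    cong₂ _,_ (sub-cong (↑*≈lift* (ctx τ ts) (λ _ _ → refl)) _ x) (fromDom-act ts is f xs)

  R₀ : Rep Sig
  R₀ = record
    { smon    = SM₀
    ; rep     = λ j ts V d → con j ts (fromDom (ins (α Sig j)) d)
    ; rep-nat = λ j ts f d → cong (con j ts) (fromDom-act ts (ins (α Sig j)) f d)
    }

module Interpretation {Sig : TypedSig} (R' : Rep Sig) where
  open Syntax Sig

  B : SAlg (S Sig)
  B = alg (smon R')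

  T' : Set
  T' = Car B

  P' : Fam T' → Fam T'
  P' = P (mon (smon R'))

  module M' = Monad (mon (smon R'))
  open KleisliLaws (mon (smon R'))

  module Along (g : T₀ → T') (hom : IsSAlgMor A₀ B g) where

    canon : (V : Fam T₀) (L : List T₀) {L' : List T'} → L.map g L ≡ L' →
            (g !) (V ⁺* L) ⇒ ((g !) V) ⁺* L'
    canon V L e t' z = subst (λ us → ((g !) V ⁺* us) t') e (can⁺* g {V} L t' z)

    reindex : ∀ {n} (τ : List (Term (S Sig) n)) (s : Term (S Sig) n)
              (ts : Vec T₀ n) (V : Fam T₀) →
              P' ((g !) (V ⁺* ctx τ ts)) (g (eval A₀ s ts)) →
              P' (((g !) V) ⁺* evτ (smon R') τ (map g ts)) (eval B s (map g ts))
    reindex τ s ts V x =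
      subst (P' _) (eval-hom A₀ B g hom s ts)
        (M'.Pmap (canon V (ctx τ ts) (evalList-hom A₀ B g hom τ ts)) _ x)

    mutual
      interp : ∀ {V} t → Tm V t → P' ((g !) V) (g t)
      interp t (var v) = M'.η (g t) (ctype g t v)
      interp {V} _ (con j ts as) =
        subst (P' ((g !) V)) (sym (eval-hom A₀ B g hom (out (α Sig j)) ts))
          (rep R' j (map g ts) ((g !) V) (interpArgs (ins (α Sig j)) as))

      interpArgs : ∀ {V n} {ts : Vec T₀ n} is → Args V ts is →
                   Dom' (smon R') is (map g ts) ((g !) V)
      interpArgs []             tt       = tt
      interpArgs {V} {ts = ts} ((τ , s) ∷ is) (x , xs) =
        reindex τ s ts V (interp _ x) , interpArgs is xs

    -- The constructor case of "interp commutes with a Kleisli map F": by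
    -- naturality of the operation of R' it reduces to the arguments.
    interp-con : ∀ {V W} (F : (g !) V ⇒ P' ((g !) W)) j ts
                 (as : Args V ts (ins (α Sig j))) (as' : Args W ts (ins (α Sig j))) →
                 interpArgs _ as'
                   ≡ domAct' (smon R') (ins (α Sig j)) (map g ts) F (interpArgs _ as) →
                 interp _ (con j ts as') ≡ M'.σ F _ (interp _ (con j ts as))
    interp-con {V} {W} F j ts as as' args = begin
      transport (rep R' j (map g ts) _ (interpArgs _ as'))
        ≡⟨ cong (λ d → transport (rep R' j (map g ts) _ d)) args ⟩
      transport (rep R' j (map g ts) _ (domAct' (smon R') _ (map g ts) F (interpArgs _ as)))
        ≡⟨ cong transport (rep-nat R' j (map g ts) F (interpArgs _ as)) ⟩
      transport (M'.σ F _ (rep R' j (map g ts) _ (interpArgs _ as)))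
        ≡⟨ subst-application′ (P' ((g !) V)) (M'.σ F) (sym eh) ⟩
      M'.σ F _ (subst (P' ((g !) V)) (sym eh) (rep R' j (map g ts) _ (interpArgs _ as)))  ∎
      where
        eh = eval-hom A₀ B g hom (out (α Sig j)) ts
        transport = subst (P' ((g !) W)) (sym eh)

    can⁺*-natural : ∀ {V W} (k : V ⇒ W) L →
                    (can⁺* g L ∘ᶠ retype g (ext⁺* L k))
                      ≈ (ext⁺* (L.map g L) (retype g k) ∘ᶠ can⁺* g L)
    can⁺*-natural k []           t' z = refl
    can⁺*-natural {V} k (u ∷ L) t' z = begin
      ext⁺* gL (can⁺ g u) t' (can⁺* g L t' (retype g (ext⁺* L (ext⁺ u k)) t' z))
        ≡⟨ cong (ext⁺* gL (can⁺ g u) t') (can⁺*-natural (ext⁺ u k) L t' z) ⟩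
      ext⁺* gL (can⁺ g u) t' (ext⁺* gL (retype g (ext⁺ u k)) t' w)
        ≡⟨ ext⁺*-∘ gL (λ _ _ → refl) t' w ⟩
      ext⁺* gL (can⁺ g u ∘ᶠ retype g (ext⁺ u k)) t' w
        ≡⟨ ext⁺*-cong gL one-step t' w ⟩
      ext⁺* gL (ext⁺ (g u) (retype g k) ∘ᶠ can⁺ g u) t' w
        ≡⟨ ext⁺*-∘ gL (λ _ _ → refl) t' w ⟨
      ext⁺* gL (ext⁺ (g u) (retype g k)) t' (ext⁺* gL (can⁺ g u) t' w)  ∎
      where
        gL = L.map g L
        w  = can⁺* g {V ⁺ u} L t' z
        one-step : (can⁺ g u ∘ᶠ retype g (ext⁺ u k))
                     ≈ (ext⁺ (g u) (retype g k) ∘ᶠ can⁺ g u)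
        one-step t' (t , p , inj₁ x)         = refl
        one-step .(g u) (.u , refl , inj₂ *) = refl

    canon-ren : ∀ {V W} (k : V ⇒ W) L {L'} (e : L.map g L ≡ L') →
                (M'.Pmap (canon W L e) ∘ᶠ (M'.η ∘ᶠ retype g (ext⁺* L k)))
                  ≈ (((M'.η ∘ᶠ retype g k) M'.↑* L') ∘ᶠ canon V L e)
    canon-ren k L refl t' z = begin
      M'.Pmap (can⁺* g L) t' (M'.η t' (retype g (ext⁺* L k) t' z))
        ≡⟨ Pmap-η (can⁺* g L) t' _ ⟩
      M'.η t' (can⁺* g L t' (retype g (ext⁺* L k) t' z))
        ≡⟨ cong (M'.η t') (can⁺*-natural k L t' z) ⟩
      M'.η t' (ext⁺* (L.map g L) (retype g k) t' (can⁺* g L t' z))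
        ≡⟨ ↑*-η (L.map g L) (λ _ _ → refl) t' _ ⟨
      ((M'.η ∘ᶠ retype g k) M'.↑* L.map g L) t' (can⁺* g L t' z)  ∎

    mutual
      interp-ren : ∀ {V W} (k : V ⇒ W) t (x : Tm V t) →
                   interp t (ren k t x) ≡ M'.Pmap (retype g k) (g t) (interp t x)
      interp-ren k t (var v)       = sym (Pmap-η (retype g k) (g t) (ctype g t v))
      interp-ren k _ (con j ts as) =
        interp-con (M'.η ∘ᶠ retype g k) j ts as _ (interpArgs-ren k (ins (α Sig j)) as)

      interpArgs-ren : ∀ {V W n} {ts : Vec T₀ n} (k : V ⇒ W) is (as : Args V ts is) →
                       interpArgs is (renArgs k is as)
                         ≡ domAct' (smon R') is (map g ts) (M'.η ∘ᶠ retype g k) (interpArgs is as)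
      interpArgs-ren k []             tt       = refl
      interpArgs-ren {V} {W} {ts = ts} k ((τ , s) ∷ is) (x , xs) = cong₂ _,_
        (trans (cong (reindex τ s ts W) (interp-ren (ext⁺* (ctx τ ts) k) _ x))
               (σ-square (canon V (ctx τ ts) eL) (canon W (ctx τ ts) eL) _ _
                         (canon-ren k (ctx τ ts) eL) (eval-hom A₀ B g hom s ts) (interp _ x)))
        (interpArgs-ren k is xs)
        where eL = evalList-hom A₀ B g hom τ ts

    f₀ : (V : Fam T₀) → (g !) (Tm V) ⇒ P' ((g !) V)
    f₀ V t' (t , p , x) = subst (P' ((g !) V)) p (interp t x)

    ⟦_⟧ˢ : ∀ {V W} → V ⇒ Tm W → (g !) V ⇒ P' ((g !) W)
    ⟦ h ⟧ˢ = f₀ _ ∘ᶠ retype g h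

    canon-sub : ∀ {V W} (h : V ⇒ Tm W) L {L'} (e : L.map g L ≡ L') →
                (M'.Pmap (canon W L e) ∘ᶠ ⟦ lift* h L ⟧ˢ)
                  ≈ ((⟦ h ⟧ˢ M'.↑* L') ∘ᶠ canon V L e)
    canon-sub h []      refl t' z = Pmap-id (λ _ _ → refl) t' _
    canon-sub {V} {W} h (u ∷ L) refl t' z = begin
      M'.Pmap (ext⁺* gL (can⁺ g u) ∘ᶠ can⁺* g L) t' (⟦ lift* (lift h u) L ⟧ˢ t' z)
        ≡⟨ Pmap-∘ (ext⁺* gL (can⁺ g u)) (can⁺* g L) t' _ ⟨
      M'.Pmap (ext⁺* gL (can⁺ g u)) t'
        (M'.Pmap (can⁺* g L) t' (⟦ lift* (lift h u) L ⟧ˢ t' z))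
        ≡⟨ cong (M'.Pmap (ext⁺* gL (can⁺ g u)) t') (canon-sub (lift h u) L refl t' z) ⟩
      M'.Pmap (ext⁺* gL (can⁺ g u)) t' ((⟦ lift h u ⟧ˢ M'.↑* gL) t' w)
        ≡⟨ Pmap-↑* gL one-step t' w ⟩
      (((⟦ h ⟧ˢ M'.↑ g u) ∘ᶠ can⁺ g u) M'.↑* gL) t' w
        ≡⟨ ↑*-ext gL (λ _ _ → refl) t' w ⟨
      ((⟦ h ⟧ˢ M'.↑ g u) M'.↑* gL) t' (ext⁺* gL (can⁺ g u) t' w)  ∎
      where
        gL = L.map g L
        w  = can⁺* g {V ⁺ u} L t' z
        -- one binder: lift weakens by inl, which interp-ren turns into Pmap inl
        one-step : (M'.Pmap (can⁺ g u) ∘ᶠ ⟦ lift h u ⟧ˢ)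
                     ≈ ((⟦ h ⟧ˢ M'.↑ g u) ∘ᶠ can⁺ g u)
        one-step .(g t) (t , refl , inj₁ v) = begin
          M'.Pmap (can⁺ g u) (g t) (interp t (ren inlᶠ t (h t v)))
            ≡⟨ cong (M'.Pmap (can⁺ g u) (g t)) (interp-ren inlᶠ t (h t v)) ⟩
          M'.Pmap (can⁺ g u) (g t) (M'.Pmap (retype g inlᶠ) (g t) (interp t (h t v)))
            ≡⟨ Pmap-∘ (can⁺ g u) (retype g inlᶠ) (g t) _ ⟩
          M'.Pmap (can⁺ g u ∘ᶠ retype g inlᶠ) (g t) (interp t (h t v))
            ≡⟨ Pmap-cong (λ { _ (_ , _ , _) → refl }) (g t) _ ⟩
          M'.Pmap inlᶠ (g t) (interp t (h t v))  ∎
        one-step .(g u) (.u , refl , inj₂ *) = Pmap-η (can⁺ g u) (g u) (u , refl , inj₂ *)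

    mutual
      interp-sub : ∀ {V W} (h : V ⇒ Tm W) t (x : Tm V t) →
                   interp t (sub h t x) ≡ M'.σ ⟦ h ⟧ˢ (g t) (interp t x)
      interp-sub h t (var v)       = sym (M'.σ-η ⟦ h ⟧ˢ (g t) (ctype g t v))
      interp-sub h _ (con j ts as) =
        interp-con ⟦ h ⟧ˢ j ts as _ (interpArgs-sub h (ins (α Sig j)) as)

      interpArgs-sub : ∀ {V W n} {ts : Vec T₀ n} (h : V ⇒ Tm W) is (as : Args V ts is) →
                       interpArgs is (subArgs h is as)
                         ≡ domAct' (smon R') is (map g ts) ⟦ h ⟧ˢ (interpArgs is as)
      interpArgs-sub h []             tt       = refl
      interpArgs-sub {V} {W} {ts = ts} h ((τ , s) ∷ is) (x , xs) = cong₂ _,_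
        (trans (cong (reindex τ s ts W) (interp-sub (lift* h (ctx τ ts)) _ x))
               (σ-square (canon V (ctx τ ts) eL) (canon W (ctx τ ts) eL) _ _
                         (canon-sub h (ctx τ ts) eL) (eval-hom A₀ B g hom s ts) (interp _ x)))
        (interpArgs-sub h is xs)
        where eL = evalList-hom A₀ B g hom τ ts

    m₀ : SMonadMor SM₀ (smon R')
    m₀ = record
      { g     = g
      ; g-hom = hom
      ; f     = f₀
      ; f-σ   = λ { h _ (t , refl , x) → interp-sub h t x }
      ; f-η   = λ { _ (t , refl , v) → refl }
      }

    interpArgs-fromDom : ∀ {V n} {ts : Vec T₀ n} is (d : Dom' SM₀ is ts V) →
                         interpArgs is (fromDom is d) ≡ mapDom R₀ R' m₀ is ts V d
    interpArgs-fromDom []             tt       = refl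
    interpArgs-fromDom ((τ , s) ∷ is) (x , xs) = cong (_ ,_) (interpArgs-fromDom is xs)

    rm₀ : RepMor R₀ R'
    rm₀ = record
      { mor    = m₀
      ; is-rep = λ j ts V d →
          trans (subst-subst-sym (eval-hom A₀ B g hom (out (α Sig j)) ts))
                (cong (rep R' j (map g ts) ((g !) V)) (interpArgs-fromDom (ins (α Sig j)) d))
      }

  -- The monad part of a morphism m' : R₀ → R' is the interpretation along
  -- its type map: induction on terms, using the axiom for m' at each
  -- constructor.
  module _ (m' : RepMor R₀ R') where
    private
      g' = g (mor m')
      open Along g' (g-hom (mor m'))

    mutual
      morphism-interp : ∀ {V} t (x : Tm V t) → f♭ (mor m') V t x ≡ interp t x
      morphism-interp t (var v)           = f-η (mor m') (g' t) (ctype g' t v)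
      morphism-interp {V} _ (con j ts as) = begin
        f♭ (mor m') V _ (con j ts as)
          ≡⟨ cong (λ d → f♭ (mor m') V _ (con j ts d)) (fromDom-toDom _ as) ⟨
        f♭ (mor m') V _ (rep R₀ j ts V (toDom _ as))
          ≡⟨ subst-sym-subst eh ⟨
        unshift (subst (P' _) eh (f♭ (mor m') V _ (rep R₀ j ts V (toDom _ as))))
          ≡⟨ cong unshift (is-rep m' j ts V (toDom _ as)) ⟩
        unshift (rep R' j (map g' ts) _ (mapDom R₀ R' (mor m') _ ts V (toDom _ as)))
          ≡⟨ cong (unshift ∘ rep R' j (map g' ts) _) (mapDom-interpArgs _ as) ⟩
        interp _ (con j ts as)  ∎
        where
          eh      = eval-hom A₀ B g' (g-hom (mor m')) (out (α Sig j)) ts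
          unshift = subst (P' ((g' !) V)) (sym eh)

      mapDom-interpArgs : ∀ {V n} {ts : Vec T₀ n} is (as : Args V ts is) →
                          mapDom R₀ R' (mor m') is ts V (toDom is as) ≡ interpArgs is as
      mapDom-interpArgs []             tt       = refl
      mapDom-interpArgs {V} {ts = ts} ((τ , s) ∷ is) (x , xs) =
        cong₂ _,_ (cong (reindex τ s ts V) (morphism-interp _ x)) (mapDom-interpArgs is xs)

    f-at : ∀ {V} t (x : Tm V t) {a} (q : g' t ≡ a) →
           f (mor m') V a (t , q , x) ≡ subst (P' ((g' !) V)) q (f♭ (mor m') V t x)
    f-at t x refl = refl

  module Invariance (g₁ : T₀ → T') (hom₁ : IsSAlgMor A₀ B g₁)
                    (g₂ : T₀ → T') (hom₂ : IsSAlgMor A₀ B g₂)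
                    (e : ∀ t → g₁ t ≡ g₂ t) where
    private
      module I₁ = Along g₁ hom₁
      module I₂ = Along g₂ hom₂

    ρ₁₂ : {V : Fam T₀} → (g₁ !) V ⇒ (g₂ !) V
    ρ₁₂ = ρ {Sig} {R₀} {R'} e

    back : ∀ t → g₂ t ≡ g₁ t
    back t = trans (sym (e t)) refl

    map-e : ∀ L → L.map g₁ L ≡ L.map g₂ L
    map-e []      = refl
    map-e (u ∷ L) = cong₂ _∷_ (e u) (map-e L)

    map-eᵛ : ∀ {n} (ts : Vec T₀ n) → map g₁ ts ≡ map g₂ ts
    map-eᵛ []       = refl
    map-eᵛ (t ∷ ts) = cong₂ _∷_ (e t) (map-eᵛ ts)

    fresh-ρ : ∀ {V u a} (eu : a ≡ g₂ u) (q : g₂ u ≡ a) →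
              subst (λ b → ((g₂ !) V ⁺ b) a) eu (inj₂ *)
                ≡ can⁺ g₂ {V} u a (u , q , inj₂ *)
    fresh-ρ eu refl with uip eu refl
    ... | refl = refl

    can⁺-ρ : ∀ {V} u t' (z : (g₁ !) (V ⁺ u) t') →
             subst (λ a → ((g₂ !) V ⁺ a) t') (e u) (ext⁺ (g₁ u) ρ₁₂ t' (can⁺ g₁ u t' z))
               ≡ can⁺ g₂ u t' (ρ₁₂ t' z)
    can⁺-ρ u t' (t , p , inj₁ v)         = subst-inj₁ {Y = (g₂ !) _} (e u)
    can⁺-ρ u .(g₁ u) (.u , refl , inj₂ *) = fresh-ρ (e u) (back u)

    can⁺*-ρ : ∀ {V} L (eL : L.map g₁ L ≡ L.map g₂ L) t' (z : (g₁ !) (V ⁺* L) t') →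
              subst (λ us → ((g₂ !) V ⁺* us) t') eL
                (ext⁺* (L.map g₁ L) ρ₁₂ t' (can⁺* g₁ L t' z))
                ≡ can⁺* g₂ L t' (ρ₁₂ t' z)
    can⁺*-ρ []      refl t' z = refl
    can⁺*-ρ {V} (u ∷ L) eL t' z with uip eL (map-e (u ∷ L))
    ... | refl = begin
      subst (λ us → ((g₂ !) V ⁺* us) t') (map-e (u ∷ L))
        (ext⁺* g₁L (ext⁺ (g₁ u) ρ₁₂) t' (ext⁺* g₁L (can⁺ g₁ u) t' w))
        ≡⟨ subst-∷ ((g₂ !) V) t' (e u) (map-e L) _ ⟩
      substL (substᵤ (ext⁺* g₁L (ext⁺ (g₁ u) ρ₁₂) t' (ext⁺* g₁L (can⁺ g₁ u) t' w)))
        ≡⟨ cong (substL ∘ substᵤ) (ext⁺*-∘ g₁L (λ _ _ → refl) t' w) ⟩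
      substL (substᵤ (ext⁺* g₁L (ext⁺ (g₁ u) ρ₁₂ ∘ᶠ can⁺ g₁ u) t' w))
        ≡⟨ cong substL (subst-ext⁺* g₁L (e u) _ _ (can⁺-ρ u) t' w) ⟩
      substL (ext⁺* g₁L (can⁺ g₂ u ∘ᶠ ρ₁₂) t' w)
        ≡⟨ subst-ext⁺*-∘ (map-e L) (can⁺ g₂ u) ρ₁₂ t' w ⟩
      ext⁺* g₂L (can⁺ g₂ u) t'
        (subst (λ us → ((g₂ !) (V ⁺ u) ⁺* us) t') (map-e L) (ext⁺* g₁L ρ₁₂ t' w))
        ≡⟨ cong (ext⁺* g₂L (can⁺ g₂ u) t') (can⁺*-ρ L (map-e L) t' z) ⟩
      ext⁺* g₂L (can⁺ g₂ u) t' (can⁺* g₂ L t' (ρ₁₂ t' z))  ∎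
      where
        g₁L    = L.map g₁ L
        g₂L    = L.map g₂ L
        w      = can⁺* g₁ {V ⁺ u} L t' z
        substᵤ = subst (λ a → (((g₂ !) V ⁺ a) ⁺* g₁L) t') (e u)
        substL = subst (λ us → (((g₂ !) V ⁺ g₂ u) ⁺* us) t') (map-e L)

    canon-ρ : ∀ {V} L {L₁ L₂} (e₁ : L.map g₁ L ≡ L₁) (e₂ : L.map g₂ L ≡ L₂)
              (eL : L₁ ≡ L₂) t' z →
              subst (λ us → ((g₂ !) V ⁺* us) t') eL (ext⁺* L₁ ρ₁₂ t' (I₁.canon V L e₁ t' z))
                ≡ I₂.canon V L e₂ t' (ρ₁₂ t' z)
    canon-ρ L refl refl eL = can⁺*-ρ L eL

    η-transport : ∀ {V} t (v : V t) {a} (q : g₂ t ≡ a) →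
                  subst (P' ((g₂ !) V)) q (M'.η (g₂ t) (ctype g₂ t v)) ≡ M'.η a (t , q , v)
    η-transport t v refl = refl

    -- On
    -- a constructor, both are the operation of R' at map g₁ ts resp.
    -- map g₂ ts, applied to argument tuples related by transport along
    -- map-eᵛ ts (interpArgs-ρ).
    mutual
      interp-ρ : ∀ {V} t (x : Tm V t) →
                 M'.Pmap ρ₁₂ (g₁ t) (I₁.interp t x)
                   ≡ subst (P' ((g₂ !) V)) (back t) (I₂.interp t x)
      interp-ρ t (var v) =
        trans (Pmap-η ρ₁₂ (g₁ t) (ctype g₁ t v)) (sym (η-transport t v (back t)))
      interp-ρ {V} _ (con j ts as) = begin
        M'.Pmap ρ₁₂ _ (subst (P' ((g₁ !) V)) (sym eh₁) (rep R' j (map g₁ ts) _ D₁))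
          ≡⟨ subst-application′ (P' ((g₁ !) V)) (M'.Pmap ρ₁₂) (sym eh₁) ⟨
        subst P₂ (sym eh₁) (M'.Pmap ρ₁₂ _ (rep R' j (map g₁ ts) _ D₁))
          ≡⟨ cong (subst P₂ (sym eh₁)) (rep-nat R' j (map g₁ ts) ηρ D₁) ⟨
        subst P₂ (sym eh₁) (rep R' j (map g₁ ts) _ (domAct' (smon R') is (map g₁ ts) ηρ D₁))
          ≡⟨ transport-app (λ v → Dom' (smon R') is v ((g₂ !) V)) (eval B (out (α Sig j))) P₂
                           (λ v → rep R' j v ((g₂ !) V)) (map-eᵛ ts) _ _ (interpArgs-ρ ts is as)
                           (sym eh₁) (sym eh₂) (back _) ⟩
        subst P₂ (back _) (subst P₂ (sym eh₂) (rep R' j (map g₂ ts) _ (I₂.interpArgs is as)))  ∎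
        where
          is  = ins (α Sig j)
          P₂  = P' ((g₂ !) V)
          eh₁ = eval-hom A₀ B g₁ hom₁ (out (α Sig j)) ts
          eh₂ = eval-hom A₀ B g₂ hom₂ (out (α Sig j)) ts
          D₁  = I₁.interpArgs is as
          ηρ  = M'.η ∘ᶠ ρ₁₂

      interpArgs-ρ : ∀ {V n} (ts : Vec T₀ n) is (as : Args V ts is) →
                     I₂.interpArgs is as
                       ≡ subst (λ v → Dom' (smon R') is v ((g₂ !) V)) (map-eᵛ ts)
                           (domAct' (smon R') is (map g₁ ts) (M'.η ∘ᶠ ρ₁₂)
                                    (I₁.interpArgs is as))
      interpArgs-ρ ts []             tt       = subst-tt (map-eᵛ ts)
      interpArgs-ρ ts ((τ , s) ∷ is) (x , xs) =
        trans (cong₂ _,_ (reindex-ρ τ s ts x) (interpArgs-ρ ts is xs))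
              (sym (subst-× _ _ (map-eᵛ ts) _ _))

      reindex-ρ : ∀ {V n} (τ : List (Term (S Sig) n)) (s : Term (S Sig) n) (ts : Vec T₀ n)
                  (x : Tm (V ⁺* ctx τ ts) (eval A₀ s ts)) →
                  I₂.reindex τ s ts V (I₂.interp _ x)
                    ≡ subst (λ v → P' ((g₂ !) V ⁺* evτ (smon R') τ v) (eval B s v)) (map-eᵛ ts)
                        (M'.σ ((M'.η ∘ᶠ ρ₁₂) M'.↑* evτ (smon R') τ (map g₁ ts)) _
                              (I₁.reindex τ s ts V (I₁.interp _ x)))
      reindex-ρ {V} τ s ts x = begin
        subst Q₂ h₂ (M'.Pmap C₂ (g₂ s') (I₂.interp s' x))
          ≡⟨ cong (subst Q₂ h₂) canon₂-via-ρ ⟩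
        subst Q₂ h₂ (subst Q₂ (sym q) (M'.Pmap (C₂ ∘ᶠ ρ₁₂) _ y))
          ≡⟨ cong (subst Q₂ h₂ ∘ subst Q₂ (sym q))
                  (Pmap-transport Y eL _ _ (canon-ρ L e₁ e₂ eL) _ y) ⟩
        subst Q₂ h₂ (subst Q₂ (sym q)
          (subst (λ l → P' (Y l) (g₁ s')) eL (M'.Pmap (ext⁺* L₁ ρ₁₂ ∘ᶠ C₁) _ y)))
          ≡⟨ transport-square (λ l a → P' (Y l) a) (evτ (smon R') τ) (eval B s) ve h₁ h₂ q _ ⟩
        subst Q ve (subst Q₁ h₁ (M'.Pmap (ext⁺* L₁ ρ₁₂ ∘ᶠ C₁) _ y))
          ≡⟨ cong (subst Q ve ∘ subst Q₁ h₁) (↑*-η-Pmap L₁ ρ₁₂ C₁ _ y) ⟨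
        subst Q ve (subst Q₁ h₁ (M'.σ ρ↑ _ (M'.Pmap C₁ _ y)))
          ≡⟨ cong (subst Q ve) (subst-application′ (P' ((g₁ !) V ⁺* L₁)) (M'.σ ρ↑) h₁) ⟩
        subst Q ve (M'.σ ρ↑ _ (subst (P' ((g₁ !) V ⁺* L₁)) h₁ (M'.Pmap C₁ _ y)))  ∎
        where
          Y  = λ l → (g₂ !) V ⁺* l
          L  = ctx τ ts
          s' = eval A₀ s ts
          L₁ = evτ (smon R') τ (map g₁ ts)
          ve = map-eᵛ ts
          eL = cong (evτ (smon R') τ) ve
          P₂ = P' ((g₂ !) (V ⁺* L))
          Q₁ = P' (Y L₁)
          Q₂ = P' (Y (evτ (smon R') τ (map g₂ ts)))
          Q  = λ v → P' (Y (evτ (smon R') τ v)) (eval B s v)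
          e₁ = evalList-hom A₀ B g₁ hom₁ τ ts
          e₂ = evalList-hom A₀ B g₂ hom₂ τ ts
          h₁ = eval-hom A₀ B g₁ hom₁ s ts
          h₂ = eval-hom A₀ B g₂ hom₂ s ts
          C₁ = I₁.canon V L e₁
          C₂ = I₂.canon V L e₂
          q  = back s'
          y  = I₁.interp s' x
          ρ↑ = (M'.η ∘ᶠ ρ₁₂) M'.↑* L₁

          -- the induction hypothesis for x, pushed through canon
          canon₂-via-ρ : M'.Pmap C₂ (g₂ s') (I₂.interp s' x)
                           ≡ subst Q₂ (sym q) (M'.Pmap (C₂ ∘ᶠ ρ₁₂) _ y)
          canon₂-via-ρ = begin
            M'.Pmap C₂ _ (I₂.interp s' x)
              ≡⟨ cong (M'.Pmap C₂ _) (subst-sym-subst q) ⟨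
            M'.Pmap C₂ _ (subst P₂ (sym q) (subst P₂ q (I₂.interp s' x)))
              ≡⟨ cong (M'.Pmap C₂ _ ∘ subst P₂ (sym q)) (interp-ρ s' x) ⟨
            M'.Pmap C₂ _ (subst P₂ (sym q) (M'.Pmap ρ₁₂ _ y))
              ≡⟨ subst-application′ P₂ (M'.Pmap C₂) (sym q) ⟨
            subst Q₂ (sym q) (M'.Pmap C₂ _ (M'.Pmap ρ₁₂ _ y))
              ≡⟨ cong (subst Q₂ (sym q)) (Pmap-∘ C₂ ρ₁₂ _ y) ⟩
            subst Q₂ (sym q) (M'.Pmap (C₂ ∘ᶠ ρ₁₂) _ y)  ∎

  initial-morphism : RepMor R₀ R'
  initial-morphism = Along.rm₀ (fold B) (fold-hom B)

  initial-morphism-unique : (m' : RepMor R₀ R') → RepMorEq initial-morphism m'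
  initial-morphism-unique m' = e , λ { V _ (t , refl , x) → begin
      M'.Pmap ρ₁₂ (fold B t) (Along.interp (fold B) (fold-hom B) t x)
        ≡⟨ interp-ρ t x ⟩
      subst (P' ((g' !) V)) (back t) (Along.interp g' (g-hom (mor m')) t x)
        ≡⟨ cong (subst (P' ((g' !) V)) (back t)) (morphism-interp m' t x) ⟨
      subst (P' ((g' !) V)) (back t) (f♭ (mor m') V t x)
        ≡⟨ f-at m' t x (back t) ⟨
      f (mor m') V (fold B t) (ρ₁₂ _ (t , refl , x))  ∎ }
    where
      g' = g (mor m')
      e  = fold-unique B g' (g-hom (mor m'))
      open Invariance (fold B) (fold-hom B) g' (g-hom (mor m')) e

mainTheorem5 : (Sig : TypedSig) → HasInitialRep Sig
mainTheorem5 Sig = Syntax.R₀ Sig , λ R' →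
  Interpretation.initial-morphism R' , Interpretation.initial-morphism-unique R'
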